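{- Let $\alpha_1,\dots,\alpha_k,\beta_1,\dots,\beta_k$ be positive integers with $\alpha_i\ge\beta_i$ for all $i\in[k]$, and let $\alpha=\sum_{i}\alpha_i$, $\beta=\sum_i\beta_i$. Then $$\prod_{i\in[k]}\prod_{0\le j<\beta_i}(\alpha_i-j)\le\frac{(\alpha)_\beta}{\alpha^\beta}\Big(\prod_{\beta-k+1\le j<\beta}\frac{\alpha}{\alpha-j}\Big)\prod_{i\in[k]}\alpha_i^{\beta_i}.$$
   Context: $(\alpha)_\beta=\alpha(\alpha-1)\cdots(\alpha-\beta+1)$ denotes the falling factorial. -}

module Defs where

open import Data.Nat using (ℕ; zero; suc; _+_; _*_; _∸_)
open import Data.Fin using (Fin)
import Data.Integer as ℤ
open import Data.Rational as ℚ using (ℚ; 0ℚ; 1ℚ)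

sumFin : (k : ℕ) → (Fin k → ℕ) → ℕ
sumFin zero f = 0
sumFin (suc k) f = f Fin.zero + sumFin k (λ i → f (Fin.suc i))
  where import Data.Fin as Fin

prodFin : (k : ℕ) → (Fin k → ℕ) → ℕ
prodFin zero f = 1
prodFin (suc k) f = f Fin.zero * prodFin k (λ i → f (Fin.suc i))
  where import Data.Fin as Fin

prodBelow : ℕ → (ℕ → ℕ) → ℕ
prodBelow zero f = 1
prodBelow (suc n) f = prodBelow n f * f n

prodBelowℚ : ℕ → (ℕ → ℚ) → ℚ
prodBelowℚ zero f = 1ℚ
prodBelowℚ (suc n) f = prodBelowℚ n f ℚ.* f n

-- ∏_{lo ≤ j < hi} f j  in ℚ  (empty product = 1 when hi ≤ lo)
prodRangeℚ : (lo hi : ℕ) → (ℕ → ℚ) → ℚ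
prodRangeℚ lo hi f = prodBelowℚ (hi ∸ lo) (λ j → f (lo + j))

fall : ℕ → ℕ → ℕ
fall a b = prodBelow b (λ j → a ∸ j)

-- the rational number m / n (only used with n ≠ 0; set to 0 when n = 0)
_÷ℕ_ : ℕ → ℕ → ℚ
m ÷ℕ zero = 0ℚ
m ÷ℕ suc n = ℤ.+ m ℚ./ suc n

toℚ : ℕ → ℚ
toℚ n = ℤ.+ n ℚ./ 1

-- Write R(a, c) = (a)_c / a^c.  Up to the factors α / (α − j), β − k + 1 ≤ j < β, which extend
-- (α)_{β−k+1} to (α)_β, the claim is ∏ᵢ R(αᵢ, βᵢ) ≤ R(α, β − k + 1).  It follows by merging the
-- blocks one at a time, using R(a₁, c₁) R(a₂, c₂) ≤ R(a₁ + a₂, c₁ + c₂ − 1).  The latter is an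
-- equality for c₁ = c₂ = 1, and growing c₁ by one multiplies the left side by 1 − c₁ / a₁ and the
-- right side by 1 − (c₁ + c₂ − 1) / (a₁ + a₂), which is no smaller as soon as (c₂ − 1) / a₂ ≤ c₁ / a₁.
-- This condition or its mirror image always holds, so one of the two blocks can always be grown.

module Submission where

open import Data.Nat using (ℕ; _∸_; _^_; _≤_; _+_)
open import Data.Fin using (Fin)
open import Defs

module FallingRatios where

  open import Data.Nat using (zero; suc; _*_; _<_; _≤?_; z≤n; z<s; NonZero; >-nonZero)
  open import Data.Nat.Properties
  open import Algebra.Properties.CommutativeSemigroup *-commutativeSemigroup
    using (interchange; xy∙z≈xz∙y; xy∙z≈zx∙y; x∙yz≈xz∙y)
  open import Data.Fin using () renaming (zero to fzero; suc to fsuc)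
  open import Data.Nat.Tactic.RingSolver using (solve-∀)
  open import Function using (_∘_)
  open import Relation.Binary.PropositionalEquality
  open import Relation.Nullary using (yes; no)

  infix 4 _∶_≼_∶_

  -- p ∶ q ≼ r ∶ s stands for p / q ≤ r / s, cross-multiplied so that no division occurs.
  record _∶_≼_∶_ (p q r s : ℕ) : Set where
    constructor cross
    field uncross : p * s ≤ r * q

  ≼-refl : ∀ p q → p ∶ q ≼ p ∶ q
  ≼-refl p q = cross ≤-refl

  ≼-resp : ∀ {p p′ q q′ r r′ s s′} → p ≡ p′ → q ≡ q′ → r ≡ r′ → s ≡ s′ →
           p ∶ q ≼ r ∶ s → p′ ∶ q′ ≼ r′ ∶ s′
  ≼-resp refl refl refl refl h = h

  ≼-* : ∀ {p q r s p′ q′ r′ s′} → p ∶ q ≼ r ∶ s → p′ ∶ q′ ≼ r′ ∶ s′ →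
        p * p′ ∶ q * q′ ≼ r * r′ ∶ s * s′
  ≼-* {p} {q} {r} {s} {p′} {q′} {r′} {s′} (cross h) (cross h′) = cross (begin
    p * p′ * (s * s′)   ≡⟨ interchange p p′ s s′ ⟩
    p * s * (p′ * s′)   ≤⟨ *-mono-≤ h h′ ⟩
    r * q * (r′ * q′)   ≡⟨ interchange r q r′ q′ ⟩
    r * r′ * (q * q′)   ∎)
    where open ≤-Reasoning

  ≼-trans : ∀ {p q r s t u} .{{_ : NonZero s}} → p ∶ q ≼ r ∶ s → r ∶ s ≼ t ∶ u → p ∶ q ≼ t ∶ u
  ≼-trans {p} {q} {r} {s} {t} {u} (cross h) (cross h′) = cross (*-cancelʳ-≤ (p * u) (t * q) s (begin
    p * u * s   ≡⟨ xy∙z≈xz∙y p u s ⟩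
    p * s * u   ≤⟨ *-monoˡ-≤ u h ⟩
    r * q * u   ≡⟨ xy∙z≈xz∙y r q u ⟩
    r * u * q   ≤⟨ *-monoˡ-≤ q h′ ⟩
    t * s * q   ≡⟨ xy∙z≈xz∙y t s q ⟩
    t * q * s   ∎))
    where open ≤-Reasoning

  ≼-scale : ∀ {p q r s} x → p ∶ q ≼ r ∶ s → p ∶ q ≼ r * x ∶ s * x
  ≼-scale {p} {q} {r} {s} x (cross h) = cross (begin
    p * (s * x)   ≡⟨ *-assoc p s x ⟨
    p * s * x     ≤⟨ *-monoˡ-≤ x h ⟩
    r * q * x     ≡⟨ xy∙z≈xz∙y r q x ⟩
    r * x * q     ∎)
    where open ≤-Reasoning

  ≼-clear-denominator : ∀ {p q r s} → p ∶ q ≼ r ∶ s → p ∶ 1 ≼ r * q ∶ s * 1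
  ≼-clear-denominator {p} {q} {r} {s} (cross h) = cross (begin
    p * (s * 1)   ≡⟨ cong (p *_) (*-identityʳ s) ⟩
    p * s         ≤⟨ h ⟩
    r * q         ≡⟨ *-identityʳ (r * q) ⟨
    r * q * 1     ∎)
    where open ≤-Reasoning

  sumFin-cong : ∀ k {f g : Fin k → ℕ} → (∀ i → f i ≡ g i) → sumFin k f ≡ sumFin k g
  sumFin-cong zero    f≡g = refl
  sumFin-cong (suc k) f≡g = cong₂ _+_ (f≡g fzero) (sumFin-cong k (f≡g ∘ fsuc))

  prodFin-cong : ∀ k {f g : Fin k → ℕ} → (∀ i → f i ≡ g i) → prodFin k f ≡ prodFin k g
  prodFin-cong zero    f≡g = refl
  prodFin-cong (suc k) f≡g = cong₂ _*_ (f≡g fzero) (prodFin-cong k (f≡g ∘ fsuc))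

  sumFin-mono : ∀ k {f g : Fin k → ℕ} → (∀ i → f i ≤ g i) → sumFin k f ≤ sumFin k g
  sumFin-mono zero    f≤g = z≤n
  sumFin-mono (suc k) f≤g = +-mono-≤ (f≤g fzero) (sumFin-mono k (f≤g ∘ fsuc))

  sumFin-≥ : ∀ k (f : Fin k → ℕ) → (∀ i → 1 ≤ f i) → k ≤ sumFin k f
  sumFin-≥ zero    f 1≤f = z≤n
  sumFin-≥ (suc k) f 1≤f = +-mono-≤ (1≤f fzero) (sumFin-≥ k (f ∘ fsuc) (1≤f ∘ fsuc))

  sumFin-suc : ∀ k (f : Fin k → ℕ) → sumFin k (λ i → suc (f i)) ≡ k + sumFin k f
  sumFin-suc zero    f = refl
  sumFin-suc (suc k) f = cong suc (begin
    f fzero + sumFin k (λ i → suc (f (fsuc i)))  ≡⟨ cong (f fzero +_) (sumFin-suc k (f ∘ fsuc)) ⟩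
    f fzero + (k + sumFin k (f ∘ fsuc))           ≡⟨ x∙yz≈y∙xz (f fzero) k _ ⟩
    k + (f fzero + sumFin k (f ∘ fsuc))           ∎)
    where
    open ≡-Reasoning
    open import Algebra.Properties.CommutativeSemigroup +-commutativeSemigroup using (x∙yz≈y∙xz)

  prodBelow-+ : ∀ m n (f : ℕ → ℕ) → prodBelow (m + n) f ≡ prodBelow m f * prodBelow n (λ j → f (m + j))
  prodBelow-+ m zero    f = trans (cong (λ x → prodBelow x f) (+-identityʳ m)) (sym (*-identityʳ _))
  prodBelow-+ m (suc n) f = begin
    prodBelow (m + suc n) f                                  ≡⟨ cong (λ x → prodBelow x f) (+-suc m n) ⟩
    prodBelow (m + n) f * f (m + n)                          ≡⟨ cong (_* f (m + n)) (prodBelow-+ m n f) ⟩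
    prodBelow m f * prodBelow n (λ j → f (m + j)) * f (m + n) ≡⟨ *-assoc (prodBelow m f) _ _ ⟩
    prodBelow m f * prodBelow (suc n) (λ j → f (m + j))      ∎
    where open ≡-Reasoning

  prodBelow-const : ∀ n a → prodBelow n (λ _ → a) ≡ a ^ n
  prodBelow-const zero    a = refl
  prodBelow-const (suc n) a = trans (cong (_* a) (prodBelow-const n a)) (*-comm (a ^ n) a)

  ^-positive : ∀ {a n} → n ≤ a → 0 < a ^ n
  ^-positive     {n = zero}  _   = z<s
  ^-positive {a} {suc n}     n≤a = m^n>0 a {{>-nonZero (≤-trans z<s n≤a)}} (suc n)

  ∸-positive : ∀ {a N m} j → N ≤ a → j < N ∸ m → 0 < a ∸ (m + j)
  ∸-positive {a} {N} {m} j N≤a j<N∸m = m<n⇒0<n∸m (<-≤-trans m+j<N N≤a)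
    where
    m+j<N : m + j < N
    m+j<N = ≰⇒> (λ N≤m+j → <⇒≱ j<N∸m (m≤n+o⇒m∸n≤o N m N≤m+j))

  -- (c + d) / (a₁ + a₂) ≤ c / a₁, as the mediant lies between d / a₂ and c / a₁.
  ∸-ratio-≼ : ∀ a₁ a₂ c d → d ∶ a₂ ≼ c ∶ a₁ → a₁ ∸ c ∶ a₁ ≼ a₁ + a₂ ∸ (c + d) ∶ a₁ + a₂
  ∸-ratio-≼ a₁ a₂ c d (cross h) = cross (begin
    (a₁ ∸ c) * (a₁ + a₂)            ≡⟨ *-distribʳ-∸ (a₁ + a₂) a₁ c ⟩
    a₁ * (a₁ + a₂) ∸ c * (a₁ + a₂)  ≤⟨ ∸-monoʳ-≤ (a₁ * (a₁ + a₂)) removed ⟩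
    a₁ * (a₁ + a₂) ∸ (c + d) * a₁   ≡⟨ cong (_∸ (c + d) * a₁) (*-comm a₁ (a₁ + a₂)) ⟩
    (a₁ + a₂) * a₁ ∸ (c + d) * a₁   ≡⟨ *-distribʳ-∸ a₁ (a₁ + a₂) (c + d) ⟨
    (a₁ + a₂ ∸ (c + d)) * a₁        ∎)
    where
    open ≤-Reasoning
    removed : (c + d) * a₁ ≤ c * (a₁ + a₂)
    removed = begin
      (c + d) * a₁     ≡⟨ *-distribʳ-+ a₁ c d ⟩
      c * a₁ + d * a₁  ≤⟨ +-monoʳ-≤ (c * a₁) h ⟩
      c * a₁ + c * a₂  ≡⟨ *-distribˡ-+ c a₁ a₂ ⟨
      c * (a₁ + a₂)    ∎

  BlocksMerge : ℕ → ℕ → ℕ → ℕ → Set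
  BlocksMerge a₁ a₂ m n =
    fall a₁ (suc m) * fall a₂ (suc n) ∶ a₁ ^ suc m * a₂ ^ suc n
      ≼ fall (a₁ + a₂) (suc (m + n)) ∶ (a₁ + a₂) ^ suc (m + n)

  blocksMerge-swap : ∀ a₁ a₂ m n → BlocksMerge a₁ a₂ m n → BlocksMerge a₂ a₁ n m
  blocksMerge-swap a₁ a₂ m n =
    ≼-resp (*-comm (fall a₁ (suc m)) (fall a₂ (suc n))) (*-comm (a₁ ^ suc m) (a₂ ^ suc n))
           (cong₂ fall (+-comm a₁ a₂) (cong suc (+-comm m n)))
           (cong₂ _^_ (+-comm a₁ a₂) (cong suc (+-comm m n)))

  blocksMerge-grow : ∀ a₁ a₂ m n → n ∶ a₂ ≼ suc m ∶ a₁ →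
                     BlocksMerge a₁ a₂ m n → BlocksMerge a₁ a₂ (suc m) n
  blocksMerge-grow a₁ a₂ m n h merge =
    ≼-resp (xy∙z≈xz∙y (fall a₁ (suc m)) (fall a₂ (suc n)) (a₁ ∸ suc m))
           (xy∙z≈zx∙y (a₁ ^ suc m) (a₂ ^ suc n) a₁) refl (*-comm ((a₁ + a₂) ^ suc (m + n)) (a₁ + a₂))
           (≼-* merge (∸-ratio-≼ a₁ a₂ (suc m) n h))

  blocksMerge-grow₂ : ∀ a₁ a₂ m n → m ∶ a₁ ≼ suc n ∶ a₂ →
                      BlocksMerge a₁ a₂ m n → BlocksMerge a₁ a₂ m (suc n)
  blocksMerge-grow₂ a₁ a₂ m n h merge =
    blocksMerge-swap a₂ a₁ (suc n) m (blocksMerge-grow a₂ a₁ n m h (blocksMerge-swap a₁ a₂ m n merge))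

  -- Grow whichever block keeps the hypothesis of ∸-ratio-≼ true; one of the two always does.
  blocksMerge : ∀ a₁ a₂ m n → BlocksMerge a₁ a₂ m n
  blocksMerge a₁ a₂ zero    zero    = cross (≤-reflexive (unit a₁ a₂))
    where
    unit : ∀ a₁ a₂ → 1 * a₁ * (1 * a₂) * ((a₁ + a₂) * 1) ≡ 1 * (a₁ + a₂) * (a₁ * 1 * (a₂ * 1))
    unit = solve-∀
  blocksMerge a₁ a₂ (suc m) zero    = blocksMerge-grow a₁ a₂ m zero (cross z≤n) (blocksMerge a₁ a₂ m zero)
  blocksMerge a₁ a₂ zero    (suc n) = blocksMerge-grow₂ a₁ a₂ zero n (cross z≤n) (blocksMerge a₁ a₂ zero n)
  blocksMerge a₁ a₂ (suc m) (suc n) with suc n * a₁ ≤? suc m * a₂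
  ... | yes h = blocksMerge-grow a₁ a₂ m (suc n) (cross h) (blocksMerge a₁ a₂ m (suc n))
  ... | no ¬h = blocksMerge-grow₂ a₁ a₂ (suc m) n (cross (<⇒≤ (≰⇒> ¬h))) (blocksMerge a₁ a₂ (suc m) n)

  blocksMerge-many : ∀ k (a c : Fin (suc k) → ℕ) → (∀ i → 1 ≤ a i) →
    prodFin (suc k) (λ i → fall (a i) (suc (c i))) ∶ prodFin (suc k) (λ i → a i ^ suc (c i))
      ≼ fall (sumFin (suc k) a) (suc (sumFin (suc k) c)) ∶ sumFin (suc k) a ^ suc (sumFin (suc k) c)
  blocksMerge-many zero    a c 1≤a
    rewrite +-identityʳ (a fzero) | +-identityʳ (c fzero) =
    ≼-resp refl refl (*-identityʳ _) (*-identityʳ _) (≼-refl _ _)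
  blocksMerge-many (suc k) a c 1≤a =
    ≼-trans {{nonZero}} (≼-* (≼-refl (fall a₀ (suc c₀)) (a₀ ^ suc c₀)) rest)
      (blocksMerge a₀ A′ c₀ C′)
    where
    a₀ = a fzero
    c₀ = c fzero
    A′ = sumFin (suc k) (a ∘ fsuc)
    rest = blocksMerge-many k (a ∘ fsuc) (c ∘ fsuc) (1≤a ∘ fsuc)
    C′ = sumFin (suc k) (c ∘ fsuc)
    nonZero : NonZero (a₀ ^ suc c₀ * A′ ^ suc C′)
    nonZero = m*n≢0 (a₀ ^ suc c₀) (A′ ^ suc C′)
      {{m^n≢0 a₀ (suc c₀) {{>-nonZero (1≤a fzero)}}}}
      {{m^n≢0 A′ (suc C′) {{>-nonZero (≤-trans (1≤a (fsuc fzero)) (m≤m+n _ _))}}}}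

  prodFin-fall-≼ : ∀ k (a b : Fin (suc k) → ℕ) → (∀ i → 1 ≤ b i) → (∀ i → b i ≤ a i) →
    prodFin (suc k) (λ i → fall (a i) (b i)) ∶ prodFin (suc k) (λ i → a i ^ b i)
      ≼ fall (sumFin (suc k) a) (sumFin (suc k) b ∸ k) ∶ sumFin (suc k) a ^ (sumFin (suc k) b ∸ k)
  prodFin-fall-≼ k a b 1≤b b≤a =
    ≼-resp (prodFin-cong (suc k) (λ i → cong (fall (a i)) (b≡ i)))
           (prodFin-cong (suc k) (λ i → cong (a i ^_) (b≡ i)))
           (cong (fall A) size≡) (cong (A ^_) size≡)
           (blocksMerge-many k a c (λ i → ≤-trans (1≤b i) (b≤a i)))
    where
    open ≡-Reasoning
    A = sumFin (suc k) a
    c : Fin (suc k) → ℕ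
    c i = b i ∸ 1
    C = sumFin (suc k) c
    b≡ : ∀ i → suc (c i) ≡ b i
    b≡ i = m+[n∸m]≡n (1≤b i)
    size≡ : suc C ≡ sumFin (suc k) b ∸ k
    size≡ = begin
      suc C                                    ≡⟨ m+n∸m≡n k (suc C) ⟨
      k + suc C ∸ k                            ≡⟨ cong (_∸ k) (+-suc k C) ⟩
      suc k + C ∸ k                            ≡⟨ cong (_∸ k) (sumFin-suc (suc k) c) ⟨
      sumFin (suc k) (λ i → suc (c i)) ∸ k     ≡⟨ cong (_∸ k) (sumFin-cong (suc k) b≡) ⟩
      sumFin (suc k) b ∸ k                     ∎

  ≼-fall-extend : ∀ {p q a m} N → m ≤ N → p ∶ q ≼ fall a m ∶ a ^ m →
    p ∶ q ≼ fall a N * prodBelow (N ∸ m) (λ _ → a) ∶ a ^ N * prodBelow (N ∸ m) (λ j → a ∸ (m + j))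
  ≼-fall-extend {a = a} {m} N m≤N h =
    ≼-resp refl refl extend-fall extend-pow (≼-scale (powers * tail) h)
    where
    open ≡-Reasoning
    n = N ∸ m
    powers = prodBelow n (λ _ → a)
    tail = prodBelow n (λ j → a ∸ (m + j))
    extend-fall : fall a m * (powers * tail) ≡ fall a N * powers
    extend-fall = begin
      fall a m * (powers * tail)   ≡⟨ x∙yz≈xz∙y (fall a m) powers tail ⟩
      fall a m * tail * powers     ≡⟨ cong (_* powers) (prodBelow-+ m n (a ∸_)) ⟨
      fall a (m + n) * powers      ≡⟨ cong (λ l → fall a l * powers) (m+[n∸m]≡n m≤N) ⟩
      fall a N * powers            ∎
    extend-pow : a ^ m * (powers * tail) ≡ a ^ N * tail
    extend-pow = begin
      a ^ m * (powers * tail)      ≡⟨ *-assoc (a ^ m) powers tail ⟨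
      a ^ m * powers * tail        ≡⟨ cong (λ x → a ^ m * x * tail) (prodBelow-const n a) ⟩
      a ^ m * a ^ n * tail         ≡⟨ cong (_* tail) (^-distribˡ-+-* a m n) ⟨
      a ^ (m + n) * tail           ≡⟨ cong (λ l → a ^ l * tail) (m+[n∸m]≡n m≤N) ⟩
      a ^ N * tail                 ∎

  falling-product-bound : ∀ k (a b : Fin k → ℕ) → (∀ i → 1 ≤ b i) → (∀ i → b i ≤ a i) →
    let A = sumFin k a; B = sumFin k b; lo = B ∸ k + 1 in
    prodFin k (λ i → fall (a i) (b i)) ∶ prodFin k (λ i → a i ^ b i)
      ≼ fall A B * prodBelow (B ∸ lo) (λ _ → A) ∶ A ^ B * prodBelow (B ∸ lo) (λ j → A ∸ (lo + j))
  falling-product-bound zero    a b 1≤b b≤a = ≼-refl 1 1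
  falling-product-bound (suc k) a b 1≤b b≤a =
    subst BoundFrom (sym lo≡) (≼-fall-extend B (m∸n≤m B k) (prodFin-fall-≼ k a b 1≤b b≤a))
    where
    A = sumFin (suc k) a
    B = sumFin (suc k) b
    BoundFrom : ℕ → Set
    BoundFrom l = prodFin (suc k) (λ i → fall (a i) (b i)) ∶ prodFin (suc k) (λ i → a i ^ b i)
      ≼ fall A B * prodBelow (B ∸ l) (λ _ → A) ∶ A ^ B * prodBelow (B ∸ l) (λ j → A ∸ (l + j))
    lo≡ : B ∸ suc k + 1 ≡ B ∸ k
    lo≡ = trans (+-comm (B ∸ suc k) 1) (sym (+-∸-assoc 1 (sumFin-≥ (suc k) b 1≤b)))

module RationalFractions where

  open import Data.Nat using (zero; suc; _*_; _<_; z<s)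
  open import Data.Nat.Properties using (≤-refl; m<n⇒m<1+n)
  open import Data.Integer using (+_)
  import Data.Integer as ℤ
  import Data.Integer.Properties as ℤ
  open import Data.Rational as ℚ using (ℚ; toℚᵘ)
  import Data.Rational.Properties as ℚ
  open import Data.Rational.Unnormalised as ℚᵘ using (mkℚᵘ; *≤*)
  import Data.Rational.Unnormalised.Properties as ℚᵘ
  open import Data.Product using (Σ-syntax; _×_; _,_)
  open import Relation.Binary.PropositionalEquality
  open FallingRatios using (_∶_≼_∶_; cross)

  infix 4 _≐_/_

  -- the denominator is written suc d′ so that it is visibly positive
  _≐_/_ : ℚ → ℕ → ℕ → Set
  q ≐ n / d = Σ[ d′ ∈ ℕ ] suc d′ ≡ d × toℚᵘ q ℚᵘ.≃ mkℚᵘ (+ n) d′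

  ÷ℕ-≐ : ∀ n d → 0 < d → n ÷ℕ d ≐ n / d
  ÷ℕ-≐ n (suc d′) _ = d′ , refl , ℚ.toℚᵘ-fromℚᵘ (mkℚᵘ (+ n) d′)

  *-≐ : ∀ {p q n₁ n₂ d₁ d₂} → p ≐ n₁ / d₁ → q ≐ n₂ / d₂ → p ℚ.* q ≐ n₁ * n₂ / d₁ * d₂
  *-≐ {p} {q} {n₁} {n₂} (_ , refl , p≃) (_ , refl , q≃) = _ , refl ,
    ℚᵘ.≃-trans (ℚ.toℚᵘ-homo-* p q)
      (ℚᵘ.≃-trans (ℚᵘ.*-cong p≃ q≃) (ℚᵘ.≃-reflexive (cong (λ z → mkℚᵘ z _) (sym (ℤ.pos-* n₁ n₂)))))

  prodBelowℚ-≐ : ∀ n (f g : ℕ → ℕ) → (∀ j → j < n → 0 < g j) →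
    prodBelowℚ n (λ j → f j ÷ℕ g j) ≐ prodBelow n f / prodBelow n g
  prodBelowℚ-≐ zero    f g g>0 = ÷ℕ-≐ 1 1 z<s
  prodBelowℚ-≐ (suc n) f g g>0 =
    *-≐ (prodBelowℚ-≐ n f g (λ j j<n → g>0 j (m<n⇒m<1+n j<n))) (÷ℕ-≐ (f n) (g n) (g>0 n ≤-refl))

  ≐-≤ : ∀ {p q n₁ n₂ d₁ d₂} → p ≐ n₁ / d₁ → q ≐ n₂ / d₂ → n₁ ∶ d₁ ≼ n₂ ∶ d₂ → p ℚ.≤ q
  ≐-≤ {p} {q} {n₁} {n₂} (d₁′ , refl , p≃) (d₂′ , refl , q≃) (cross n₁d₂≤n₂d₁) =
    ℚ.toℚᵘ-cancel-≤ (ℚᵘ.≤-respˡ-≃ (ℚᵘ.≃-sym p≃) (ℚᵘ.≤-respʳ-≃ (ℚᵘ.≃-sym q≃)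
      (*≤* (subst₂ ℤ._≤_ (ℤ.pos-* n₁ (suc d₂′)) (ℤ.pos-* n₂ (suc d₁′)) (ℤ.+≤+ n₁d₂≤n₂d₁)))))

open import Data.Rational using (ℚ; _*_) renaming (_≤_ to _≤ℚ_)
open import Data.Nat using (z<s)
open FallingRatios using (≼-clear-denominator; falling-product-bound; sumFin-mono; ^-positive; ∸-positive)
open RationalFractions using (÷ℕ-≐; *-≐; prodBelowℚ-≐; ≐-≤)

lemmaA1 : (k : ℕ) (a b : Fin k → ℕ) →
    (∀ i → 1 ≤ b i) → (∀ i → b i ≤ a i) →
    toℚ (prodFin k (λ i → prodBelow (b i) (λ j → a i ∸ j)))
      ≤ℚ
    (((fall (sumFin k a) (sumFin k b) ÷ℕ (sumFin k a ^ sumFin k b))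
      * prodRangeℚ (sumFin k b ∸ k + 1) (sumFin k b)
          (λ j → sumFin k a ÷ℕ (sumFin k a ∸ j)))
      * toℚ (prodFin k (λ i → a i ^ b i)))
lemmaA1 k a b 1≤b b≤a =
  ≐-≤ (÷ℕ-≐ _ 1 z<s)
      (*-≐ (*-≐ (÷ℕ-≐ _ _ (^-positive B≤A))
                (prodBelowℚ-≐ (B ∸ lo) _ _ (λ j j<n → ∸-positive {m = lo} j B≤A j<n)))
           (÷ℕ-≐ _ 1 z<s))
      (≼-clear-denominator (falling-product-bound k a b 1≤b b≤a))
  where
  A = sumFin k a
  B = sumFin k b
  lo = B ∸ k + 1
  B≤A : B ≤ A
  B≤A = sumFin-mono k b≤a
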